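{- Every chordless graph is 3-colorable.
   Context: A graph is chordless if none of its cycles (as subgraphs) has a chord, i.e. every cycle of the graph is an induced cycle. -}

module Defs where

open import Level using (0ℓ)
open import Data.Nat using (ℕ; suc; _≤_)
open import Data.Fin using (Fin; toℕ)
open import Data.Sum using (_⊎_)
open import Data.Product using (Σ; ∃; _×_; _,_)
open import Relation.Nullary using (¬_; Dec)
open import Relation.Binary.PropositionalEquality using (_≡_; _≢_)
open import Function.Definitions using (Injective)

record Graph (n : ℕ) : Set₁ where
  field
    Adj   : Fin n → Fin n → Set
    sym   : ∀ {x y} → Adj x y → Adj y x
    irrefl : ∀ {x} → ¬ Adj x x
    dec   : ∀ x y → Dec (Adj x y)
open Graph public

Succ : (k : ℕ) → Fin k → Fin k → Set
Succ k i j = (toℕ j ≡ suc (toℕ i)) ⊎ (suc (toℕ i) ≡ k × toℕ j ≡ 0)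

Consecutive : (k : ℕ) → Fin k → Fin k → Set
Consecutive k i j = Succ k i j ⊎ Succ k j i

record Cycle {n : ℕ} (G : Graph n) (k : ℕ) : Set where
  field
    len≥3 : 3 ≤ k
    vtx   : Fin k → Fin n
    inj   : Injective _≡_ _≡_ vtx
    edge  : ∀ (i j : Fin k) → Succ k i j → Adj G (vtx i) (vtx j)
open Cycle public

HasChord : {n : ℕ} (G : Graph n) {k : ℕ} → Cycle G k → Set
HasChord G {k} C =
  Σ (Fin k) λ i → Σ (Fin k) λ j →
    ¬ Consecutive k i j × Adj G (vtx C i) (vtx C j)

Chordless : {n : ℕ} → Graph n → Set
Chordless G = ∀ (k : ℕ) (C : Cycle G k) → ¬ HasChord G C

Colorable : {n : ℕ} → Graph n → ℕ → Set
Colorable {n} G c =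
  Σ (Fin n → Fin c) λ col → ∀ x y → Adj G x y → col x ≢ col y

-- Every nonempty chordless graph has a vertex of degree at most 2, so induction on the
-- number of vertices colours G - v and then v with a colour missed by its two neighbours.
-- Such a vertex is the start v of a maximal path: all neighbours of v lie on the path, and
-- if two of them other than its successor did, the farther one would close a cycle through v
-- in which the edge to the nearer one is a chord.

module Submission where

open import Defs

open import Data.Nat using (ℕ; zero; suc; _+_; _<_; _≤_; s≤s; z≤n)
open import Data.Nat.Properties
  using (≤-trans; <-≤-trans; <⇒≤; <-irrefl; <-cmp; n<1+n; n≮0; +-suc; +-identityʳ; ≤-<-connex; suc-injective)
open import Data.Fin using (Fin; toℕ; fromℕ<; punchIn; punchOut; _≟_)
  renaming (zero to fzero; suc to fsuc)
open import Data.Fin.Properties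
  using (toℕ<n; toℕ-injective; toℕ-fromℕ<; pigeonhole; any?; punchIn-injective; punchIn-punchOut)
open import Data.Vec.Functional using (insertAt)
open import Data.Vec.Functional.Properties using (insertAt-lookup; insertAt-punchIn)
open import Data.Sum using (_⊎_; inj₁; inj₂)
open import Data.Product using (Σ; ∃; ∃₂; _×_; _,_)
open import Data.Empty using (⊥-elim)
open import Relation.Nullary using (¬_; yes; no)
open import Relation.Nullary.Decidable using (_×-dec_; ¬?)
open import Relation.Unary using (Pred; Decidable)
open import Relation.Binary.Definitions using (tri<; tri≈; tri>)
open import Relation.Binary.PropositionalEquality
  using (_≡_; _≢_; refl; trans; cong; subst)
  renaming (sym to ≡-sym)

private
  variable
    n m : ℕ

record Path (G : Graph n) : Set where
  field
    length           : ℕ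
    vertex           : ℕ → Fin n
    vertex-injective : ∀ {i j} → i < length → j < length → vertex i ≡ vertex j → i ≡ j
    step             : ∀ {i} → suc i < length → Adj G (vertex i) (vertex (suc i))

  start : Fin n
  start = vertex 0

  OnPath : Pred (Fin n) _
  OnPath x = ∃ λ (i : Fin length) → vertex (toℕ i) ≡ x

  onPath? : Decidable OnPath
  onPath? x = any? λ i → vertex (toℕ i) ≟ x

open Path

MaximalPath : {G : Graph n} → Path G → Set
MaximalPath {G = G} P = ∀ x → Adj G (start P) x → OnPath P x

length≤n : {G : Graph n} (P : Path G) → length P ≤ n
length≤n {n} P with ≤-<-connex (length P) n
... | inj₁ L≤n = L≤n
... | inj₂ n<L with pigeonhole n<L (λ i → vertex P (toℕ i))
... | i , j , i<j , same =
  ⊥-elim (<-irrefl (vertex-injective P (toℕ<n i) (toℕ<n j) same) i<j)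

trivialPath : {G : Graph n} → Fin n → Path G
trivialPath v = record
  { length = 1
  ; vertex = λ _ → v
  ; vertex-injective = λ { (s≤s z≤n) (s≤s z≤n) _ → refl }
  ; step = λ { (s≤s ()) } }

prepend : {G : Graph n} (P : Path G) (x : Fin n) →
          Adj G (start P) x → ¬ OnPath P x → Path G
prepend {G = G} P x adj x∉P = record
  { length = suc (length P) ; vertex = vertex′ ; vertex-injective = injective′ ; step = step′ }
  where
  vertex′ : ℕ → _
  vertex′ zero    = x
  vertex′ (suc i) = vertex P i

  injective′ : ∀ {i j} → i < suc (length P) → j < suc (length P) → vertex′ i ≡ vertex′ j → i ≡ j
  injective′ {zero}  {zero}  _       _       _  = refl
  injective′ {zero}  {suc j} _       (s≤s j<) eq =
    ⊥-elim (x∉P (fromℕ< j< , trans (cong (vertex P) (toℕ-fromℕ< j<)) (≡-sym eq)))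
  injective′ {suc i} {zero}  (s≤s i<) _       eq =
    ⊥-elim (x∉P (fromℕ< i< , trans (cong (vertex P) (toℕ-fromℕ< i<)) eq))
  injective′ {suc i} {suc j} (s≤s i<) (s≤s j<) eq = cong suc (vertex-injective P i< j< eq)

  step′ : ∀ {i} → suc i < suc (length P) → Adj G (vertex′ i) (vertex′ (suc i))
  step′ {zero}  _         = sym G adj
  step′ {suc i} (s≤s i<L) = step P i<L

-- Paths have at most n vertices, so the invariant n < length + fuel keeps the fuel from running out.
extendToMaximal : {G : Graph n} (fuel : ℕ) (P : Path G) →
                  n < length P + fuel → Σ (Path G) MaximalPath
extendToMaximal {n} zero P n<L+0 =
  ⊥-elim (<-irrefl refl (<-≤-trans n<L+0 (subst (_≤ n) (≡-sym (+-identityʳ _)) (length≤n P))))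
extendToMaximal {n} {G} (suc fuel) P n<L+fuel
  with any? (λ x → dec G (start P) x ×-dec ¬? (onPath? P x))
... | yes (x , adj , x∉P) =
  extendToMaximal fuel (prepend P x adj x∉P) (subst (n <_) (+-suc (length P) fuel) n<L+fuel)
... | no stuck = P , maximal
  where
  maximal : MaximalPath P
  maximal x adj with onPath? P x
  ... | yes x∈P = x∈P
  ... | no  x∉P = ⊥-elim (stuck (x , adj , x∉P))

maximalPath : {G : Graph n} → Fin n → Σ (Path G) MaximalPath
maximalPath {n} v = extendToMaximal n (trivialPath v) (n<1+n n)

closeCycle : {G : Graph n} (P : Path G) {j : ℕ} → 2 ≤ j → j < length P →
             Adj G (vertex P j) (start P) → Cycle G (suc j)
closeCycle {G = G} P {j} 2≤j j<L back = record
  { len≥3 = s≤s 2≤j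
  ; vtx   = λ c → vertex P (toℕ c)
  ; inj   = λ {c} {d} eq → toℕ-injective (vertex-injective P (bound c) (bound d) eq)
  ; edge  = edge′ }
  where
  bound : (c : Fin (suc j)) → toℕ c < length P
  bound c = ≤-trans (toℕ<n c) j<L

  edge′ : ∀ c d → Succ (suc j) c d → Adj G (vertex P (toℕ c)) (vertex P (toℕ d))
  edge′ c d (inj₁ d≡c+1) rewrite d≡c+1 = step P (subst (_< length P) d≡c+1 (bound d))
  edge′ c d (inj₂ (c+1≡k , d≡0)) rewrite d≡0 | suc-injective c+1≡k = back

zero-nonconsecutive : ∀ {j} (d : Fin (suc j)) → 2 ≤ toℕ d → toℕ d < j →
                      ¬ Consecutive (suc j) fzero d
zero-nonconsecutive d 2≤d d<j (inj₁ (inj₁ d≡1))          = <-irrefl (≡-sym d≡1) 2≤d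
zero-nonconsecutive d 2≤d d<j (inj₁ (inj₂ (1≡k , _)))    =
  n≮0 (subst (toℕ d <_) (≡-sym (suc-injective 1≡k)) d<j)
zero-nonconsecutive d 2≤d d<j (inj₂ (inj₂ (d+1≡k , _))) = <-irrefl (suc-injective d+1≡k) d<j

chordless-noTwoFarNeighbours : {G : Graph n} → Chordless G → (P : Path G) →
  ∀ {i j} → 2 ≤ i → i < j → j < length P →
  Adj G (start P) (vertex P i) → ¬ Adj G (start P) (vertex P j)
chordless-noTwoFarNeighbours {G = G} chordless P {i} {j} 2≤i i<j j<L adjᵢ adjⱼ =
  chordless (suc j) (closeCycle P (≤-trans 2≤i (<⇒≤ i<j)) j<L (sym G adjⱼ))
    (fzero , d , zero-nonconsecutive d 2≤d d<j , subst (Adj G (start P)) (≡-sym vertex-d) adjᵢ)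
  where
  d : Fin (suc j)
  d = fromℕ< (s≤s (<⇒≤ i<j))

  toℕd≡i : toℕ d ≡ i
  toℕd≡i = toℕ-fromℕ< (s≤s (<⇒≤ i<j))

  2≤d : 2 ≤ toℕ d
  2≤d = subst (2 ≤_) (≡-sym toℕd≡i) 2≤i

  d<j : toℕ d < j
  d<j = subst (_< j) (≡-sym toℕd≡i) i<j

  vertex-d : vertex P (toℕ d) ≡ vertex P i
  vertex-d = cong (vertex P) toℕd≡i

chordless-farNeighbour-unique : {G : Graph n} → Chordless G → (P : Path G) →
  ∀ {i j} → 2 ≤ i → 2 ≤ j → i < length P → j < length P →
  Adj G (start P) (vertex P i) → Adj G (start P) (vertex P j) → i ≡ j
chordless-farNeighbour-unique chordless P {i} {j} 2≤i 2≤j i<L j<L adjᵢ adjⱼ with <-cmp i j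
... | tri< i<j _ _ = ⊥-elim (chordless-noTwoFarNeighbours chordless P 2≤i i<j j<L adjᵢ adjⱼ)
... | tri≈ _ i≡j _ = i≡j
... | tri> _ _ j<i = ⊥-elim (chordless-noTwoFarNeighbours chordless P 2≤j j<i i<L adjⱼ adjᵢ)

HasDegree≤2 : Graph n → Fin n → Set
HasDegree≤2 G v = ∃₂ λ a b → ∀ x → Adj G v x → x ≡ a ⊎ x ≡ b

coveredByTwo : ∀ {ℓ} {Q : Pred (Fin n) ℓ} → Decidable Q → (a : Fin n) →
               (∀ {y z} → Q y → Q z → y ≢ a → z ≢ a → y ≡ z) →
               ∃ λ b → ∀ x → Q x → x ≡ a ⊎ x ≡ b
coveredByTwo {Q = Q} Q? a unique with any? (λ x → Q? x ×-dec ¬? (x ≟ a))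
... | yes (b , Qb , b≢a) = b , covered
  where
  covered : ∀ x → Q x → x ≡ a ⊎ x ≡ b
  covered x Qx with x ≟ a
  ... | yes x≡a = inj₁ x≡a
  ... | no  x≢a = inj₂ (unique Qx Qb x≢a b≢a)
... | no noOther = a , covered
  where
  covered : ∀ x → Q x → x ≡ a ⊎ x ≡ a
  covered x Qx with x ≟ a
  ... | yes x≡a = inj₁ x≡a
  ... | no  x≢a = ⊥-elim (noOther (x , Qx , x≢a))

maximalPath-start-degree≤2 : {G : Graph n} → Chordless G → (P : Path G) → MaximalPath P →
                              HasDegree≤2 G (start P)
maximalPath-start-degree≤2 {G = G} chordless P maximal =
  let b , covered = coveredByTwo (dec G (start P)) (vertex P 1) unique
  in vertex P 1 , b , covered
  where
  farIndex : ∀ {y} → Adj G (start P) y → y ≢ vertex P 1 →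
             ∀ i → i < length P → vertex P i ≡ y → ∃ λ i → 2 ≤ i × i < length P × vertex P i ≡ y
  farIndex adj y≢a zero          _   refl = ⊥-elim (irrefl G adj)
  farIndex adj y≢a (suc zero)    _   refl = ⊥-elim (y≢a refl)
  farIndex adj y≢a (suc (suc i)) i<L eq   = suc (suc i) , s≤s (s≤s z≤n) , i<L , eq

  position : ∀ {y} → Adj G (start P) y → y ≢ vertex P 1 →
             ∃ λ i → 2 ≤ i × i < length P × vertex P i ≡ y
  position adj y≢a =
    let i , eq = maximal _ adj in farIndex adj y≢a (toℕ i) (toℕ<n i) eq

  unique : ∀ {y z} → Adj G (start P) y → Adj G (start P) z →
           y ≢ vertex P 1 → z ≢ vertex P 1 → y ≡ z
  unique adjy adjz y≢a z≢a with position adjy y≢a | position adjz z≢a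
  ... | i , 2≤i , i<L , refl | j , 2≤j , j<L , refl =
    cong (vertex P) (chordless-farNeighbour-unique chordless P 2≤i 2≤j i<L j<L adjy adjz)

chordless-degree≤2 : {G : Graph n} → Chordless G → Fin n → ∃ (HasDegree≤2 G)
chordless-degree≤2 chordless v =
  let P , maximal = maximalPath v
  in start P , maximalPath-start-degree≤2 chordless P maximal

delete : Graph (suc m) → Fin (suc m) → Graph m
delete G v = record
  { Adj    = λ x y → Adj G (punchIn v x) (punchIn v y)
  ; sym    = sym G
  ; irrefl = irrefl G
  ; dec    = λ x y → dec G (punchIn v x) (punchIn v y) }

delete-chordless : (G : Graph (suc m)) (v : Fin (suc m)) → Chordless G → Chordless (delete G v)
delete-chordless G v chordless k C chord = chordless k C′ chord
  where
  C′ : Cycle G k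
  C′ = record
    { len≥3 = len≥3 C
    ; vtx   = λ c → punchIn v (vtx C c)
    ; inj   = λ eq → inj C (punchIn-injective v _ _ eq)
    ; edge  = edge C }

punchIn-view : (v x : Fin (suc m)) → x ≡ v ⊎ ∃ λ x′ → x ≡ punchIn v x′
punchIn-view v x with v ≟ x
... | yes v≡x = inj₁ (≡-sym v≡x)
... | no  v≢x = inj₂ (punchOut v≢x , ≡-sym (punchIn-punchOut v≢x))

avoidTwo : ∀ {k} (a b : Fin (3 + k)) → ∃ λ c → c ≢ a × c ≢ b
avoidTwo (fsuc _)        (fsuc _)        = fzero , (λ ()) , (λ ())
avoidTwo fzero           fzero           = fsuc fzero , (λ ()) , (λ ())
avoidTwo fzero           (fsuc fzero)    = fsuc (fsuc fzero) , (λ ()) , (λ ())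
avoidTwo fzero           (fsuc (fsuc _)) = fsuc fzero , (λ ()) , (λ ())
avoidTwo (fsuc fzero)    fzero           = fsuc (fsuc fzero) , (λ ()) , (λ ())
avoidTwo (fsuc (fsuc _)) fzero           = fsuc fzero , (λ ()) , (λ ())

colouring-insert : ∀ {k} (G : Graph (suc m)) (v : Fin (suc m)) (col : Fin m → Fin k) →
  (∀ x y → Adj (delete G v) x y → col x ≢ col y) →
  (c : Fin k) → (∀ y → Adj G v (punchIn v y) → c ≢ col y) → Colorable G k
colouring-insert G v col proper c c≢neighbour = insertAt col v c , proper′
  where
  proper′ : ∀ x y → Adj G x y → insertAt col v c x ≢ insertAt col v c y
  proper′ x y adj with punchIn-view v x | punchIn-view v y
  ... | inj₁ refl | inj₁ refl = ⊥-elim (irrefl G adj)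
  ... | inj₁ refl | inj₂ (y′ , refl)
    rewrite insertAt-lookup col v c | insertAt-punchIn col v c y′ =
      c≢neighbour y′ adj
  ... | inj₂ (x′ , refl) | inj₁ refl
    rewrite insertAt-lookup col v c | insertAt-punchIn col v c x′ =
      λ eq → c≢neighbour x′ (sym G adj) (≡-sym eq)
  ... | inj₂ (x′ , refl) | inj₂ (y′ , refl)
    rewrite insertAt-punchIn col v c x′ | insertAt-punchIn col v c y′ =
      proper x′ y′ adj

-- a and b may coincide with v, so their colours are read off a provisional extension
-- of col; the value it places at v is irrelevant.
colouring-insertDegree≤2 : ∀ {k} (G : Graph (suc m)) (v : Fin (suc m)) → HasDegree≤2 G v →
                           Colorable (delete G v) (3 + k) → Colorable G (3 + k)
colouring-insertDegree≤2 G v (a , b , neighbours) (col , proper)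
  with avoidTwo (insertAt col v fzero a) (insertAt col v fzero b)
... | c , c≢a , c≢b = colouring-insert G v col proper c c≢neighbour
  where
  c≢neighbour : ∀ y → Adj G v (punchIn v y) → c ≢ col y
  c≢neighbour y adj with neighbours (punchIn v y) adj
  ... | inj₁ refl = subst (c ≢_) (insertAt-punchIn col v fzero y) c≢a
  ... | inj₂ refl = subst (c ≢_) (insertAt-punchIn col v fzero y) c≢b

mainTheorem10 : ∀ (n : ℕ) (G : Graph n) → Chordless G → Colorable G 3
mainTheorem10 zero    G chordless = (λ ()) , (λ ())
mainTheorem10 (suc m) G chordless =
  let v , degree≤2 = chordless-degree≤2 chordless fzero
  in colouring-insertDegree≤2 G v degree≤2
       (mainTheorem10 m (delete G v) (delete-chordless G v chordless))
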